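{- A positive integer $x>1$ is a $\tau_7$-atom if and only if one of the following holds: (i) $x$ is prime; (ii) $x=7p_1p_2\cdots p_k$ with $k\ge 0$ and each $p_i$ a prime different from $7$; (iii) in the prime factorization of $x$ (primes counted with multiplicity), every prime factor is congruent to $\pm1\pmod 7$ except for exactly one, which is congruent to $\pm2\pmod 7$; (iv) in the prime factorization of $x$, every prime factor is congruent to $\pm1\pmod 7$ except for exactly one, which is congruent to $\pm3\pmod 7$; (v) $x=pq$ with $p,q$ primes, $p\equiv\pm2\pmod 7$ and $q\equiv\pm 3\pmod 7$.
   Context: For a positive integer $n$ and integers $x,y$, write $x\,\tau_n\,y$ if $x\equiv y \pmod n$. For a nonzero nonunit integer $x$, a $\tau_n$-factorization of $x$ is an expression $x=\lambda a_1a_2\cdots a_k$ with $\lambda\in\{1,-1\}$, each $a_i$ a nonzero nonunit integer (i.e. $a_i\neq 0,\pm1$), and $a_i\equiv a_j \pmod n$ for all $i,j$; it is proper if $k>1$. A nonzero nonunit integer $x$ is a $\tau_n$-atom if it has no proper $\tau_n$-factorization. "Prime" means a positive prime number. -}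

module Defs where

open import Data.Nat as ℕ using (ℕ; _%_)
open import Data.Nat.Primality using (Prime)
open import Data.Integer as ℤ using (ℤ; +_; -_; _-_; _*_; 1ℤ; -1ℤ; 0ℤ)
open import Data.Integer.Divisibility using (_∣_)
open import Data.List as List using (List; []; _∷_; _++_; length)
open import Data.List.Relation.Unary.All using (All)
open import Data.Product using (Σ; _×_; ∃; ∃-syntax)
open import Data.Sum using (_⊎_)
open import Relation.Binary.PropositionalEquality using (_≡_; _≢_)
open import Relation.Nullary using (¬_)

_τ[_]_ : ℤ → ℕ → ℤ → Set
x τ[ n ] y = (+ n) ∣ (x - y)

NonzeroNonunit : ℤ → Set
NonzeroNonunit a = (a ≢ 0ℤ) × (a ≢ 1ℤ) × (a ≢ -1ℤ)

prodℤ : List ℤ → ℤ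
prodℤ = List.foldr _*_ 1ℤ

record τFactorization (n : ℕ) (x : ℤ) : Set where
  field
    λ' : ℤ
    λ-unit : (λ' ≡ 1ℤ) ⊎ (λ' ≡ -1ℤ)
    factors : List ℤ
    nonempty : 1 ℕ.≤ length factors
    nzNu : All NonzeroNonunit factors
    pairwiseCong : All (λ a → All (λ b → a τ[ n ] b) factors) factors
    product : x ≡ λ' * prodℤ factors

Proper : {n : ℕ} {x : ℤ} → τFactorization n x → Set
Proper f = 1 ℕ.< length (τFactorization.factors f)

τAtom : ℕ → ℤ → Set
τAtom n x = NonzeroNonunit x × ¬ (Σ (τFactorization n x) Proper)

prodℕ : List ℕ → ℕ
prodℕ = List.foldr ℕ._*_ 1

≡±_mod7 : ℕ → ℕ → Set
(≡± a mod7) p = (p % 7 ≡ a) ⊎ (p % 7 ≡ 7 ℕ.∸ a)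

ExactlyOneExceptional : ℕ → ℕ → Set
ExactlyOneExceptional a x =
  ∃[ as ] ∃[ p ] ∃[ bs ]
    (All Prime (as ++ p ∷ bs) × prodℕ (as ++ p ∷ bs) ≡ x
     × All (≡± 1 mod7) as × All (≡± 1 mod7) bs × (≡± a mod7) p)

module Submission where

-- Write class(n) ∈ {±1, ±2, ±3, 0} for the residue of n mod 7 up to sign.  Since
-- the factors of a τ₇-factorization may be re-signed freely, a positive x has a
-- proper τ₇-factorization iff it "splits": x = n₁⋯n_k with k ≥ 2, every nᵢ ≥ 2 and
-- all nᵢ of one class.  Away from 0 the classes form the cyclic group of order 3
-- generated by ±2 (±2·±2 = ±3, ±2·±3 = ±1), and class is multiplicative.
--
-- The
-- five listed shapes do not split: in any splitting of x = p·Q (p prime) the part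
-- carrying p is m·p and another part b has m·b ∣ Q, which each shape forbids.
-- Conversely, for a non-splitting x we sort the prime factors by class and show
-- that any deviation from the five shapes exhibits a splitting: either a proper
-- factor a whose class squares to class(x) (a "square root"), or three factors
-- of one nonunit class when class(x) = ±1.  The theorem combines both directions.

open import Defs
open import Data.Nat using (ℕ; _<_; _*_; _%_)
open import Data.Nat.Primality using (Prime)
open import Data.Integer using (+_)
open import Data.List using (List)
open import Data.List.Relation.Unary.All using (All)
open import Data.Product using (_×_; ∃-syntax)
open import Data.Sum using (_⊎_)
open import Function.Bundles using (_⇔_)
open import Relation.Binary.PropositionalEquality using (_≡_; _≢_)

open import Data.Nat as ℕ using (zero; suc; _∸_; _≤_; z≤n; s≤s; _≤?_)
import Data.Nat.Properties as ℕP
open import Data.Nat.DivMod using (m%n<n; %-distribˡ-*)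
open import Data.Nat.Divisibility as ℕ∣ using (_∣_; divides; _∣?_)
open import Data.Nat.Primality using (euclidsLemma; prime?; prime⇒nonZero; prime⇒nonTrivial; prime⇒irreducible; productOfPrimes≢0)
open import Data.Nat.Primality.Factorisation using (factorise; factorisationHasAllPrimeFactors; module PrimeFactorisation)
open import Data.Nat.ListAction.Properties using (∈⇒∣product; product-++; product-↭)
open import Data.Nat.Tactic.RingSolver using (solve-∀)
open import Data.Integer as ℤ using (ℤ; -[1+_]; -_; _%ℕ_; _/ℕ_; ∣_∣; 1ℤ; -1ℤ)
import Data.Integer.Properties as ℤP
open import Data.Integer.DivMod using (a≡a%ℕn+[a/ℕn]*n; n%ℕd<d)
import Data.Integer.Divisibility.Signed as ℤ∣
import Data.Integer.Tactic.RingSolver as ℤSolver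
open import Data.List using ([]; _∷_; _++_; length; map)
import Data.List.Properties as ListP
open import Data.List.Membership.Propositional using (_∈_)
open import Data.List.Relation.Binary.Permutation.Propositional.Properties using (shift)
open import Data.List.Relation.Unary.All as All using ([]; _∷_)
import Data.List.Relation.Unary.All.Properties as AllP
open import Data.Product using (Σ; _,_; proj₁; proj₂)
open import Data.Sum using (inj₁; inj₂)
open import Data.Empty using (⊥-elim)
open import Function using (_∘_)
open import Function.Bundles using (mk⇔)
open import Relation.Binary.PropositionalEquality using (refl; sym; trans; cong; cong₂; subst; module ≡-Reasoning)
open import Relation.Nullary using (Dec; yes; no; ¬_)
open import Relation.Nullary.Decidable using (from-yes; map′; _⊎-dec_)

data Class : Set where
  ±1 ±2 ±3 0₇ : Class

residueClass : ℕ → Class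
residueClass 1 = ±1
residueClass 2 = ±2
residueClass 3 = ±3
residueClass 4 = ±3
residueClass 5 = ±2
residueClass 6 = ±1
residueClass _ = 0₇

canon : Class → ℕ
canon ±1 = 1
canon ±2 = 2
canon ±3 = 3
canon 0₇ = 0

residueClass-canon : ∀ c → residueClass (canon c) ≡ c
residueClass-canon ±1 = refl
residueClass-canon ±2 = refl
residueClass-canon ±3 = refl
residueClass-canon 0₇ = refl

infix 4 _≟ᶜ_
_≟ᶜ_ : (c d : Class) → Dec (c ≡ d)
c ≟ᶜ d = map′ canon-injective (cong canon) (canon c ℕ.≟ canon d)
  where
  canon-injective : canon c ≡ canon d → c ≡ d
  canon-injective e = trans (sym (residueClass-canon c)) (trans (cong residueClass e) (residueClass-canon d))

infixr 7 _·_
_·_ : Class → Class → Class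
0₇ · _  = 0₇
±1 · c  = c
±2 · 0₇ = 0₇
±2 · ±1 = ±2
±2 · ±2 = ±3
±2 · ±3 = ±1
±3 · 0₇ = 0₇
±3 · ±1 = ±3
±3 · ±2 = ±1
±3 · ±3 = ±2

residueClass-mul : ∀ {i j} → i < 7 → j < 7 → residueClass ((i * j) % 7) ≡ residueClass i · residueClass j
residueClass-mul i<7 j<7 = from-yes (ℕP.allUpTo? (λ i → ℕP.allUpTo? (λ j →
  residueClass ((i * j) % 7) ≟ᶜ residueClass i · residueClass j) 7) 7) i<7 j<7

residueClass-neg : ∀ r → residueClass (7 ∸ r) ≡ residueClass r
residueClass-neg 0 = refl
residueClass-neg 1 = refl
residueClass-neg 2 = refl
residueClass-neg 3 = refl
residueClass-neg 4 = refl
residueClass-neg 5 = refl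
residueClass-neg 6 = refl
residueClass-neg (suc (suc (suc (suc (suc (suc (suc r))))))) = cong residueClass (ℕP.0∸n≡0 r)

residue-±canon : ∀ {r} → r < 7 → r ≡ canon (residueClass r) ⊎ r ≡ 7 ∸ canon (residueClass r)
residue-±canon = from-yes (ℕP.allUpTo? (λ r → (r ℕ.≟ canon (residueClass r)) ⊎-dec (r ℕ.≟ 7 ∸ canon (residueClass r))) 7)

canon-residueClass : ∀ {r} → r ≤ 3 → canon (residueClass r) ≡ r
canon-residueClass r≤3 = from-yes (ℕP.allUpTo? (λ r → canon (residueClass r) ℕ.≟ r) 4) (s≤s r≤3)

class : ℕ → Class
class n = residueClass (n % 7)

class-mul : ∀ m n → class (m * n) ≡ class m · class n
class-mul m n = trans (cong residueClass (%-distribˡ-* m n 7)) (residueClass-mul (m%n<n m 7) (m%n<n n 7))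

class⇒±mod7 : ∀ n {c} → class n ≡ c → (≡± canon c mod7) n
class⇒±mod7 n refl = residue-±canon (m%n<n n 7)

±mod7⇒class : ∀ {a} n → (≡± a mod7) n → class n ≡ residueClass a
±mod7⇒class     _ (inj₁ n%7≡a)   = cong residueClass n%7≡a
±mod7⇒class {a} _ (inj₂ n%7≡7-a) = trans (cong residueClass n%7≡7-a) (residueClass-neg a)

±mod7⇒class≢ : ∀ {a c} n → (≡± a mod7) n → residueClass a ≢ c → class n ≢ c
±mod7⇒class≢ n n≡±a a≢c cn≡c = a≢c (trans (sym (±mod7⇒class n n≡±a)) cn≡c)

class≡0₇⇒7∣ : ∀ {n} → class n ≡ 0₇ → 7 ∣ n
class≡0₇⇒7∣ {n} cn≡0 with class⇒±mod7 n cn≡0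
... | inj₁ n%7≡0 = ℕ∣.m%n≡0⇒n∣m n 7 n%7≡0
... | inj₂ n%7≡7 = ⊥-elim (ℕP.<-irrefl n%7≡7 (m%n<n n 7))

class-prod-±1 : ∀ {qs} → All (λ q → class q ≡ ±1) qs → class (prodℕ qs) ≡ ±1
class-prod-±1 []                  = refl
class-prod-±1 {q ∷ qs} (cq ∷ cqs) = trans (class-mul q (prodℕ qs)) (cong₂ _·_ cq (class-prod-±1 cqs))

·-zeroʳ : ∀ c → c · 0₇ ≡ 0₇
·-zeroʳ ±1 = refl
·-zeroʳ ±2 = refl
·-zeroʳ ±3 = refl
·-zeroʳ 0₇ = refl

infix 8 _⁻¹
_⁻¹ : Class → Class
±1 ⁻¹ = ±1
±2 ⁻¹ = ±3
±3 ⁻¹ = ±2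
0₇ ⁻¹ = 0₇

⁻¹-cancel : ∀ c d → c ≢ 0₇ → c ⁻¹ · c · d ≡ d
⁻¹-cancel ±1 d  _   = refl
⁻¹-cancel ±2 ±1 _   = refl
⁻¹-cancel ±2 ±2 _   = refl
⁻¹-cancel ±2 ±3 _   = refl
⁻¹-cancel ±2 0₇ _   = refl
⁻¹-cancel ±3 ±1 _   = refl
⁻¹-cancel ±3 ±2 _   = refl
⁻¹-cancel ±3 ±3 _   = refl
⁻¹-cancel ±3 0₇ _   = refl
⁻¹-cancel 0₇ _  c≢0 = ⊥-elim (c≢0 refl)

·-cancelˡ : ∀ c {d e} → c ≢ 0₇ → c · d ≡ c · e → d ≡ e
·-cancelˡ c {d} {e} c≢0 cd≡ce = begin
  d               ≡⟨ ⁻¹-cancel c d c≢0 ⟨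
  c ⁻¹ · c · d    ≡⟨ cong (c ⁻¹ ·_) cd≡ce ⟩
  c ⁻¹ · c · e    ≡⟨ ⁻¹-cancel c e c≢0 ⟩
  e               ∎
  where open ≡-Reasoning

data Generator : Class → Set where
  ±2-generates : Generator ±2
  ±3-generates : Generator ±3

generator≢0₇ : ∀ {d} → Generator d → d ≢ 0₇
generator≢0₇ ±2-generates ()
generator≢0₇ ±3-generates ()

generator≢±1 : ∀ {d} → Generator d → d ≢ ±1
generator≢±1 ±2-generates ()
generator≢±1 ±3-generates ()

generator-square : ∀ {d} → Generator d → Generator (d · d)
generator-square ±2-generates = ±3-generates
generator-square ±3-generates = ±2-generates

square≢generator : ∀ {d} → Generator d → d · d ≢ d
square≢generator ±2-generates ()
square≢generator ±3-generates ()

generator-cube : ∀ {d} → Generator d → d · d · d ≡ ±1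
generator-cube ±2-generates = refl
generator-cube ±3-generates = refl

square-root-of-generator : ∀ {d} → Generator d → (d · d) · (d · d) ≡ d
square-root-of-generator ±2-generates = refl
square-root-of-generator ±3-generates = refl

nonzero-classes : ∀ {d} → Generator d → ∀ c → c ≢ 0₇ → c ≡ ±1 ⊎ c ≡ d ⊎ c ≡ d · d
nonzero-classes _            ±1 _   = inj₁ refl
nonzero-classes ±2-generates ±2 _   = inj₂ (inj₁ refl)
nonzero-classes ±2-generates ±3 _   = inj₂ (inj₂ refl)
nonzero-classes ±3-generates ±2 _   = inj₂ (inj₂ refl)
nonzero-classes ±3-generates ±3 _   = inj₂ (inj₁ refl)
nonzero-classes _            0₇ c≢0 = ⊥-elim (c≢0 refl)

residue-abs : ∀ a → residueClass (a %ℕ 7) ≡ class ∣ a ∣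
residue-abs (+ n)    = refl
residue-abs -[1+ n ] with suc n % 7
... | zero  = refl
... | suc r = residueClass-neg (suc r)

multiple-of-7<7 : ∀ {d} → 7 ∣ d → d < 7 → d ≡ 0
multiple-of-7<7 {zero}  _   _   = refl
multiple-of-7<7 {suc d} 7∣d d<7 = ⊥-elim (ℕP.<⇒≱ d<7 (ℕ∣.∣⇒≤ 7∣d))

-- Congruent integers leave the same remainder: the remainders differ by a
-- multiple of 7 of absolute value below 7.
τ⇒%ℕ≡ : ∀ a b → a τ[ 7 ] b → a %ℕ 7 ≡ b %ℕ 7
τ⇒%ℕ≡ a b 7∣a-b = ℤP.+-injective (ℤP.i-j≡0⇒i≡j ra rb (ℤP.∣i∣≡0⇒i≡0 ∣ra-rb∣≡0))
  where
  ra = + (a %ℕ 7)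
  rb = + (b %ℕ 7)
  regroup : ∀ r s q t → (r ℤ.+ q ℤ.* + 7) ℤ.- (s ℤ.+ t ℤ.* + 7) ≡ (r ℤ.- s) ℤ.+ (q ℤ.- t) ℤ.* + 7
  regroup = ℤSolver.solve-∀
  a-b≡ : a ℤ.- b ≡ (ra ℤ.- rb) ℤ.+ (a /ℕ 7 ℤ.- b /ℕ 7) ℤ.* + 7
  a-b≡ = trans (cong₂ ℤ._-_ (a≡a%ℕn+[a/ℕn]*n a 7) (a≡a%ℕn+[a/ℕn]*n b 7)) (regroup ra rb (a /ℕ 7) (b /ℕ 7))
  7∣ra-rb : + 7 ℤ∣.∣ (ra ℤ.- rb)
  7∣ra-rb = ℤ∣.∣m+n∣n⇒∣m (subst (+ 7 ℤ∣.∣_) a-b≡ (ℤ∣.∣ᵤ⇒∣ 7∣a-b)) (ℤ∣.∣n⇒∣m*n (a /ℕ 7 ℤ.- b /ℕ 7) ℤ∣.∣-refl)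
  ∣ra-rb∣<7 : ∣ ra ℤ.- rb ∣ < 7
  ∣ra-rb∣<7 = begin-strict
    ∣ ra ℤ.- rb ∣            ≡⟨ cong ∣_∣ (ℤP.[+m]-[+n]≡m⊖n (a %ℕ 7) (b %ℕ 7)) ⟩
    ∣ a %ℕ 7 ℤ.⊖ b %ℕ 7 ∣    ≤⟨ ℤP.∣m⊝n∣≤m⊔n (a %ℕ 7) (b %ℕ 7) ⟩
    a %ℕ 7 ℕ.⊔ b %ℕ 7        <⟨ ℕP.⊔-lub (n%ℕd<d a 7) (n%ℕd<d b 7) ⟩
    7                        ∎
    where open ℕP.≤-Reasoning
  ∣ra-rb∣≡0 : ∣ ra ℤ.- rb ∣ ≡ 0
  ∣ra-rb∣≡0 = multiple-of-7<7 (ℤ∣.∣⇒∣ᵤ 7∣ra-rb) ∣ra-rb∣<7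

%ℕ≡⇒τ : ∀ a b → a %ℕ 7 ≡ b %ℕ 7 → a τ[ 7 ] b
%ℕ≡⇒τ a b same = ℤ∣.∣⇒∣ᵤ (ℤ∣.divides (a /ℕ 7 ℤ.- b /ℕ 7) a-b≡)
  where
  cancel : ∀ r q t → (r ℤ.+ q ℤ.* + 7) ℤ.- (r ℤ.+ t ℤ.* + 7) ≡ (q ℤ.- t) ℤ.* + 7
  cancel = ℤSolver.solve-∀
  a-b≡ : a ℤ.- b ≡ (a /ℕ 7 ℤ.- b /ℕ 7) ℤ.* + 7
  a-b≡ = begin
    a ℤ.- b                                                              ≡⟨ cong₂ ℤ._-_ (a≡a%ℕn+[a/ℕn]*n a 7) (a≡a%ℕn+[a/ℕn]*n b 7) ⟩
    (+ (a %ℕ 7) ℤ.+ a /ℕ 7 ℤ.* + 7) ℤ.- (+ (b %ℕ 7) ℤ.+ b /ℕ 7 ℤ.* + 7)  ≡⟨ cong (λ r → (+ r ℤ.+ a /ℕ 7 ℤ.* + 7) ℤ.- (+ (b %ℕ 7) ℤ.+ b /ℕ 7 ℤ.* + 7)) same ⟩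
    (+ (b %ℕ 7) ℤ.+ a /ℕ 7 ℤ.* + 7) ℤ.- (+ (b %ℕ 7) ℤ.+ b /ℕ 7 ℤ.* + 7)  ≡⟨ cancel (+ (b %ℕ 7)) (a /ℕ 7) (b /ℕ 7) ⟩
    (a /ℕ 7 ℤ.- b /ℕ 7) ℤ.* + 7                                          ∎
    where open ≡-Reasoning

τ⇒class : ∀ a b → a τ[ 7 ] b → class ∣ a ∣ ≡ class ∣ b ∣
τ⇒class a b a≡b = begin
  class ∣ a ∣              ≡⟨ residue-abs a ⟨
  residueClass (a %ℕ 7)    ≡⟨ cong residueClass (τ⇒%ℕ≡ a b a≡b) ⟩
  residueClass (b %ℕ 7)    ≡⟨ residue-abs b ⟩
  class ∣ b ∣              ∎
  where open ≡-Reasoning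

lift : ℕ → ℤ
lift n with n % 7 ≤? 3
... | yes _ = + n
... | no _  = - + n

∣lift∣ : ∀ n → ∣ lift n ∣ ≡ n
∣lift∣ n with n % 7 ≤? 3
... | yes _ = refl
... | no _  = ℤP.∣-i∣≡∣i∣ (+ n)

lift-small : ∀ n → lift n %ℕ 7 ≤ 3
lift-small n with n % 7 ≤? 3
... | yes r≤3 = r≤3
... | no r≰3  = negated n r≰3
  where
  negated : ∀ n → ¬ (n % 7 ≤ 3) → (- + n) %ℕ 7 ≤ 3
  negated zero    r≰3 = ⊥-elim (r≰3 z≤n)
  negated (suc m) r≰3 with suc m % 7 | r≰3
  ... | zero  | r≰3 = ⊥-elim (r≰3 z≤n)
  ... | suc r | r≰3 = ℕP.∸-monoʳ-≤ 7 (ℕP.≰⇒> r≰3)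

-- The lift of n has the canonical remainder of class(n), so lifts of numbers of
-- one class are pairwise congruent.
lift-residue : ∀ n → lift n %ℕ 7 ≡ canon (class n)
lift-residue n = begin
  lift n %ℕ 7                          ≡⟨ canon-residueClass (lift-small n) ⟨
  canon (residueClass (lift n %ℕ 7))   ≡⟨ cong canon (residue-abs (lift n)) ⟩
  canon (class ∣ lift n ∣)             ≡⟨ cong (canon ∘ class) (∣lift∣ n) ⟩
  canon (class n)                      ∎
  where open ≡-Reasoning

nonzeroNonunit⇒2≤ : ∀ {z} → NonzeroNonunit z → 2 ≤ ∣ z ∣
nonzeroNonunit⇒2≤ {+ 0}            (z≢0 , _ , _)  = ⊥-elim (z≢0 refl)
nonzeroNonunit⇒2≤ {+ 1}            (_ , z≢1 , _)  = ⊥-elim (z≢1 refl)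
nonzeroNonunit⇒2≤ {+ suc (suc _)}  _              = s≤s (s≤s z≤n)
nonzeroNonunit⇒2≤ { -[1+ 0 ] }     (_ , _ , z≢-1) = ⊥-elim (z≢-1 refl)
nonzeroNonunit⇒2≤ { -[1+ suc _ ] } _              = s≤s (s≤s z≤n)

2≤⇒nonzeroNonunit : ∀ {z} → 2 ≤ ∣ z ∣ → NonzeroNonunit z
2≤⇒nonzeroNonunit {+ 1}            (s≤s ())
2≤⇒nonzeroNonunit {+ suc (suc _)}  _        = (λ ()) , (λ ()) , (λ ())
2≤⇒nonzeroNonunit { -[1+ 0 ] }     (s≤s ())
2≤⇒nonzeroNonunit { -[1+ suc _ ] } _        = (λ ()) , (λ ()) , (λ ())

abs-prod : ∀ zs → ∣ prodℤ zs ∣ ≡ prodℕ (map ∣_∣ zs)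
abs-prod []       = refl
abs-prod (z ∷ zs) = trans (ℤP.abs-* z (prodℤ zs)) (cong (∣ z ∣ ℕ.*_) (abs-prod zs))

abs-unit : ∀ {u} → (u ≡ 1ℤ) ⊎ (u ≡ -1ℤ) → ∀ y → ∣ u ℤ.* y ∣ ≡ ∣ y ∣
abs-unit (inj₁ refl) y = cong ∣_∣ (ℤP.*-identityˡ y)
abs-unit (inj₂ refl) y = trans (cong ∣_∣ (ℤP.-1*i≡-i y)) (ℤP.∣-i∣≡∣i∣ y)

sign-unit : ∀ y → ∃[ u ] ((u ≡ 1ℤ) ⊎ (u ≡ -1ℤ)) × + ∣ y ∣ ≡ u ℤ.* y
sign-unit (+ n)    = 1ℤ , inj₁ refl , sym (ℤP.*-identityˡ (+ n))
sign-unit -[1+ n ] = -1ℤ , inj₂ refl , sym (ℤP.-1*i≡-i -[1+ n ])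

record Splitting (x : ℕ) : Set where
  field
    parts    : List ℕ
    common   : Class
    several  : 1 < length parts
    parts-ok : All (λ n → 2 ≤ n × class n ≡ common) parts
    product  : prodℕ parts ≡ x

absolute-splitting : ∀ zs → 1 < length zs → All NonzeroNonunit zs → All (λ a → All (a τ[ 7 ]_) zs) zs →
                     Splitting (prodℕ (map ∣_∣ zs))
absolute-splitting zs@(a ∷ _) several nonunits (a≡all ∷ _) = record
  { parts    = map ∣_∣ zs
  ; common   = class ∣ a ∣
  ; several  = subst (1 <_) (sym (ListP.length-map ∣_∣ zs)) several
  ; parts-ok = AllP.map⁺ (All.zipWith (λ {b} (nonunit , a≡b) → nonzeroNonunit⇒2≤ nonunit , sym (τ⇒class a b a≡b))
                                      (nonunits , a≡all))
  ; product  = refl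
  }

proper⇒splitting : ∀ {x} → Σ (τFactorization 7 (+ x)) Proper → Splitting x
proper⇒splitting {x} (fac , several) = subst Splitting Π∣factors∣≡x (absolute-splitting factors several nzNu pairwiseCong)
  where
  open τFactorization fac
  Π∣factors∣≡x : prodℕ (map ∣_∣ factors) ≡ x
  Π∣factors∣≡x = begin
    prodℕ (map ∣_∣ factors)    ≡⟨ abs-prod factors ⟨
    ∣ prodℤ factors ∣          ≡⟨ abs-unit λ-unit (prodℤ factors) ⟨
    ∣ λ' ℤ.* prodℤ factors ∣   ≡⟨ cong ∣_∣ product ⟨
    x                          ∎
    where open ≡-Reasoning

same-residue⇒pairwise : ∀ {r} zs → All (λ z → z %ℕ 7 ≡ r) zs → All (λ a → All (a τ[ 7 ]_) zs) zs
same-residue⇒pairwise zs ≡r = All.map (λ {a} a≡r → All.map (λ {b} b≡r → %ℕ≡⇒τ a b (trans a≡r (sym b≡r))) ≡r) ≡r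

splitting⇒proper : ∀ {x} → Splitting x → Σ (τFactorization 7 (+ x)) Proper
splitting⇒proper {x} s = factorization , several′
  where
  open Splitting s
  zs = map lift parts
  several′ : 1 < length zs
  several′ = subst (1 <_) (sym (ListP.length-map lift parts)) several
  ∣zs∣≡parts : map ∣_∣ zs ≡ parts
  ∣zs∣≡parts = trans (sym (ListP.map-∘ parts)) (ListP.map-id-local (All.tabulate (λ {n} _ → ∣lift∣ n)))
  ∣Πzs∣≡x : ∣ prodℤ zs ∣ ≡ x
  ∣Πzs∣≡x = trans (abs-prod zs) (trans (cong prodℕ ∣zs∣≡parts) product)
  sign = sign-unit (prodℤ zs)
  factorization : τFactorization 7 (+ x)
  factorization = record
    { λ'           = proj₁ sign
    ; λ-unit       = proj₁ (proj₂ sign)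
    ; factors      = zs
    ; nonempty     = ℕP.<⇒≤ several′
    ; nzNu         = AllP.map⁺ (All.map (λ {n} (2≤n , _) → 2≤⇒nonzeroNonunit (subst (2 ≤_) (sym (∣lift∣ n)) 2≤n)) parts-ok)
    ; pairwiseCong = same-residue⇒pairwise zs (AllP.map⁺ (All.map (λ {n} (_ , cn) → trans (lift-residue n) (cong canon cn)) parts-ok))
    ; product      = trans (cong +_ (sym ∣Πzs∣≡x)) (proj₂ (proj₂ sign))
    }

PrimeOf : Class → ℕ → Set
PrimeOf c p = Prime p × class p ≡ c

prime[7] : Prime 7
prime[7] = from-yes (prime? 7)

prime⇒2≤ : ∀ {p} → Prime p → 2 ≤ p
prime⇒2≤ {p} pp = ℕ.nonTrivial⇒n>1 p {{prime⇒nonTrivial pp}}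

record Separation (P : ℕ → Set) (p : ℕ) (ns : List ℕ) : Set where
  constructor separation
  field
    chosen        : ℕ
    others        : List ℕ
    chosen-ok     : P chosen
    p∣chosen      : p ∣ chosen
    others-ok     : All P others
    length-others : length ns ≡ suc (length others)
    product-split : prodℕ ns ≡ chosen * prodℕ others

separate : ∀ {P : ℕ → Set} {p} → Prime p → ∀ ns → All P ns → p ∣ prodℕ ns → Separation P p ns
separate {p = p} pp [] [] p∣1 = ⊥-elim (ℕP.<-irrefl (sym (ℕ∣.∣1⇒≡1 p∣1)) (prime⇒2≤ pp))
separate pp (n ∷ ns) (Pn ∷ Pns) p∣Π with euclidsLemma n (prodℕ ns) pp p∣Π
... | inj₁ p∣n   = separation n ns Pn p∣n Pns refl refl
... | inj₂ p∣Πns with separate pp ns Pns p∣Πns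
...   | separation m rest Pm p∣m Prest len Πns≡ =
        separation m (n ∷ rest) Pm p∣m (Pn ∷ Prest) (cong suc len) (trans (cong (n *_) Πns≡) (swap n m (prodℕ rest)))
  where
  swap : ∀ a b c → a * (b * c) ≡ b * (a * c)
  swap = solve-∀

splitting-through-prime : ∀ {x p Q} → Splitting x → Prime p → x ≡ p * Q →
                          ∃[ m ] ∃[ b ] (m * b ∣ Q × 2 ≤ b × class (m * p) ≡ class b)
splitting-through-prime {x} {p} {Q} s pp x≡pQ = through (separate pp parts parts-ok p∣Πparts)
  where
  open Splitting s
  instance _ = prime⇒nonZero pp
  p∣Πparts : p ∣ prodℕ parts
  p∣Πparts = subst (p ∣_) (trans (sym x≡pQ) (sym product)) (ℕ∣.m∣m*n Q)
  regroup : ∀ m p b r → m * p * (b * r) ≡ p * (m * b * r)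
  regroup = solve-∀
  through : Separation (λ n → 2 ≤ n × class n ≡ common) p parts → ∃[ m ] ∃[ b ] (m * b ∣ Q × 2 ≤ b × class (m * p) ≡ class b)
  through (separation _ [] _ _ _ len _) = ⊥-elim (ℕP.<-irrefl refl (subst (1 <_) len several))
  through (separation _ (b ∷ rest) (_ , cmp) (divides m refl) ((2≤b , cb) ∷ _) _ Π≡) = m , b , mb∣Q , 2≤b , trans cmp (sym cb)
    where
    Q≡ : Q ≡ m * b * prodℕ rest
    Q≡ = ℕP.*-cancelˡ-≡ Q (m * b * prodℕ rest) p (trans (sym x≡pQ) (trans (sym product) (trans Π≡ (regroup m p b (prodℕ rest)))))
    mb∣Q : m * b ∣ Q
    mb∣Q = subst (m * b ∣_) (sym Q≡) (ℕ∣.m∣m*n (prodℕ rest))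

-- Every divisor of a product of ±1-primes has class ±1 (its prime factors occur
-- among those primes).
unit-divisor : ∀ {qs d} → All (PrimeOf ±1) qs → d ∣ prodℕ qs → class d ≡ ±1
unit-divisor {qs} {d} qs-ok d∣Π = subst (λ n → class n ≡ ±1) (sym isFactorisation) (class-prod-±1 (All.tabulate factor-class))
  where
  qs-prime = All.map proj₁ qs-ok
  d≢0 : d ≢ 0
  d≢0 refl = ℕ.≢-nonZero⁻¹ (prodℕ qs) {{productOfPrimes≢0 qs-prime}} (ℕ∣.0∣⇒≡0 d∣Π)
  instance _ = ℕ.≢-nonZero d≢0
  open PrimeFactorisation (factorise d)
  factor-class : ∀ {r} → r ∈ factors → class r ≡ ±1
  factor-class {r} r∈ = proj₂ (All.lookup qs-ok (factorisationHasAllPrimeFactors (All.lookup factorsPrime r∈)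
                          (ℕ∣.∣-trans (subst (r ∣_) (sym isFactorisation) (∈⇒∣product r∈)) d∣Π) qs-prime))

-- A prime: the other part would divide 1.
prime-nonsplit : ∀ {x} → Prime x → ¬ Splitting x
prime-nonsplit {x} px s with splitting-through-prime s px (sym (ℕP.*-identityʳ x))
... | m , b , mb∣1 , 2≤b , _ = ℕP.<-irrefl (sym (ℕ∣.∣1⇒≡1 (ℕ∣.m*n∣⇒n∣ m b mb∣1))) 2≤b

-- The part through 7 has class 0₇, so the other part is a multiple of 7 too.
seven-nonsplit : ∀ {ps} → All (λ p → Prime p × p ≢ 7) ps → ¬ Splitting (7 * prodℕ ps)
seven-nonsplit {ps} ps-ok s with splitting-through-prime s prime[7] refl
... | m , b , mb∣Π , _ , cm7≡cb = proj₂ (All.lookup ps-ok 7∈ps) refl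
  where
  7∣b : 7 ∣ b
  7∣b = class≡0₇⇒7∣ (trans (sym cm7≡cb) (trans (class-mul m 7) (·-zeroʳ (class m))))
  7∈ps : 7 ∈ ps
  7∈ps = factorisationHasAllPrimeFactors prime[7] (ℕ∣.∣-trans 7∣b (ℕ∣.m*n∣⇒n∣ m b mb∣Π)) (All.map proj₁ ps-ok)

-- Both parts would have class ±1, but the part through p has the class of p.
exceptional-nonsplit : ∀ {p qs} → Prime p → class p ≢ ±1 → All (PrimeOf ±1) qs → ¬ Splitting (p * prodℕ qs)
exceptional-nonsplit {p} pp cp≢±1 qs-ok s with splitting-through-prime s pp refl
... | m , b , mb∣Π , _ , cmp≡cb = cp≢±1 (begin
  class p              ≡⟨ cong (_· class p) (unit-divisor qs-ok (ℕ∣.m*n∣⇒m∣ m b mb∣Π)) ⟨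
  class m · class p    ≡⟨ class-mul m p ⟨
  class (m * p)        ≡⟨ cmp≡cb ⟩
  class b              ≡⟨ unit-divisor qs-ok (ℕ∣.m*n∣⇒n∣ m b mb∣Π) ⟩
  ±1                   ∎)
  where open ≡-Reasoning

-- The only splitting candidate of p·q is {p, q}.
pq-nonsplit : ∀ {p q} → Prime p → Prime q → class p ≢ class q → ¬ Splitting (p * q)
pq-nonsplit {p} {q} pp pq cp≢cq s with splitting-through-prime s pp refl
... | m , b , mb∣q , 2≤b , cmp≡cb with prime⇒irreducible pq (ℕ∣.m*n∣⇒n∣ m b mb∣q)
...   | inj₁ refl = ℕP.<-irrefl refl 2≤b
...   | inj₂ refl = cp≢cq (trans (cong class (sym (ℕP.*-identityˡ p))) (subst (λ m → class (m * p) ≡ class q) m≡1 cmp≡cb))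
  where
  instance _ = prime⇒nonZero pq
  m≡1 : m ≡ 1
  m≡1 = ℕ∣.∣1⇒≡1 (ℕ∣.*-cancelʳ-∣ q (subst (m * q ∣_) (sym (ℕP.*-identityˡ q)) mb∣q))

-- Shapes (iii) and (iv): move the exceptional prime p to the front.
exceptional-form-nonsplit : ∀ {a x} → residueClass a ≢ ±1 → ExactlyOneExceptional a x → ¬ Splitting x
exceptional-form-nonsplit {x = x} a≢±1 (as , p , bs , primes , Π≡x , as≡±1 , bs≡±1 , p≡±a) =
  subst (¬_ ∘ Splitting) x≡pQ (exceptional-nonsplit p-prime (±mod7⇒class≢ p p≡±a a≢±1)
                                 (AllP.++⁺ (units as as≡±1 as-prime) (units bs bs≡±1 bs-prime)))
  where
  as-prime = AllP.++⁻ˡ as primes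
  p-prime  = All.head (AllP.++⁻ʳ as primes)
  bs-prime = All.tail (AllP.++⁻ʳ as primes)
  units : ∀ qs → All (≡± 1 mod7) qs → All Prime qs → All (PrimeOf ±1) qs
  units qs ±1s prime = All.zipWith (λ {q} (q-prime , q≡±1) → q-prime , ±mod7⇒class q q≡±1) (prime , ±1s)
  x≡pQ : p * prodℕ (as ++ bs) ≡ x
  x≡pQ = trans (sym (product-↭ (shift p as bs))) Π≡x

Forms : ℕ → Set
Forms x = Prime x
        ⊎ (∃[ ps ] (All (λ p → Prime p × p ≢ 7) ps × x ≡ 7 * prodℕ ps))
        ⊎ ExactlyOneExceptional 2 x
        ⊎ ExactlyOneExceptional 3 x
        ⊎ (∃[ p ] ∃[ q ] (Prime p × Prime q × (≡± 2 mod7) p × (≡± 3 mod7) q × x ≡ p * q))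

form⇒nonsplit : ∀ {x} → Forms x → ¬ Splitting x
form⇒nonsplit (inj₁ x-prime)                           = prime-nonsplit x-prime
form⇒nonsplit (inj₂ (inj₁ (_ , ps-ok , refl)))         = seven-nonsplit ps-ok
form⇒nonsplit (inj₂ (inj₂ (inj₁ exceptional)))        = exceptional-form-nonsplit (λ ()) exceptional
form⇒nonsplit (inj₂ (inj₂ (inj₂ (inj₁ exceptional)))) = exceptional-form-nonsplit (λ ()) exceptional
form⇒nonsplit (inj₂ (inj₂ (inj₂ (inj₂ (p , q , p-prime , q-prime , p≡±2 , q≡±3 , refl))))) =
  pq-nonsplit p-prime q-prime (λ cp≡cq → ±mod7⇒class≢ q q≡±3 (λ ()) (trans (sym cp≡cq) (±mod7⇒class p p≡±2)))

≢0,1⇒2≤ : ∀ {r} → r ≢ 0 → r ≢ 1 → 2 ≤ r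
≢0,1⇒2≤ {0}           r≢0 _   = ⊥-elim (r≢0 refl)
≢0,1⇒2≤ {1}           _   r≢1 = ⊥-elim (r≢1 refl)
≢0,1⇒2≤ {suc (suc _)} _   _   = s≤s (s≤s z≤n)

class⇒2≤ : ∀ {r} → class r ≢ 0₇ → class r ≢ ±1 → 2 ≤ r
class⇒2≤ c≢0 c≢±1 = ≢0,1⇒2≤ (λ { refl → c≢0 refl }) (λ { refl → c≢±1 refl })

split₂ : ∀ {x a b} → x ≡ a * b → 2 ≤ a → 2 ≤ b → class a ≡ class b → Splitting x
split₂ {a = a} {b} x≡ab 2≤a 2≤b ca≡cb = record
  { parts    = a ∷ b ∷ []
  ; common   = class b
  ; several  = s≤s (s≤s z≤n)
  ; parts-ok = (2≤a , ca≡cb) ∷ (2≤b , refl) ∷ []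
  ; product  = trans (cong (a *_) (ℕP.*-identityʳ b)) (sym x≡ab)
  }

split₃ : ∀ {a b c} → 2 ≤ a → 2 ≤ b → 2 ≤ c → class a ≡ class c → class b ≡ class c → Splitting (a * (b * c))
split₃ {a} {b} {c} 2≤a 2≤b 2≤c ca≡cc cb≡cc = record
  { parts    = a ∷ b ∷ c ∷ []
  ; common   = class c
  ; several  = s≤s (s≤s z≤n)
  ; parts-ok = (2≤a , ca≡cc) ∷ (2≤b , cb≡cc) ∷ (2≤c , refl) ∷ []
  ; product  = cong (λ c′ → a * (b * c′)) (ℕP.*-identityʳ c)
  }

-- If x = a·r where the class of a is a square root of class(x), then r has the
-- class of a; so unless r = 1, x splits as a · r.
root-or-split : ∀ {x a r c} → x ≡ a * r → 2 ≤ a → class a ≡ c → c ≢ 0₇ → c · c ≡ class x → ¬ Splitting x → x ≡ a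
root-or-split {x} {a} {r} {c} x≡ar 2≤a ca≡c c≢0 root unsplittable with r ℕ.≟ 1
... | yes refl = trans x≡ar (ℕP.*-identityʳ a)
... | no r≢1   = ⊥-elim (unsplittable (split₂ x≡ar 2≤a (≢0,1⇒2≤ (λ { refl → c≢0 (sym cr≡c) }) r≢1) (trans ca≡c (sym cr≡c))))
  where
  cr≡c : class r ≡ c
  cr≡c = ·-cancelˡ c c≢0 (begin
    c · class r          ≡⟨ cong (_· class r) ca≡c ⟨
    class a · class r    ≡⟨ class-mul a r ⟨
    class (a * r)        ≡⟨ cong class x≡ar ⟨
    class x              ≡⟨ root ⟨
    c · c                ∎)
    where open ≡-Reasoning

-- A product x > 1 of primes of one generator class d, with class(x) = ±1, has at
-- least three factors and splits as g₁ · g₂ · (rest), all of class d.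
power-splits : ∀ {d} → Generator d → ∀ ps → All (PrimeOf d) ps → 1 < prodℕ ps → class (prodℕ ps) ≡ ±1 → Splitting (prodℕ ps)
power-splits gen [] [] (s≤s ()) _
power-splits gen (g ∷ []) ((_ , cg) ∷ []) _ cΠ≡±1 =
  ⊥-elim (generator≢±1 gen (trans (sym cg) (trans (cong class (sym (ℕP.*-identityʳ g))) cΠ≡±1)))
power-splits {d} gen (g₁ ∷ g₂ ∷ []) ((_ , c₁) ∷ (_ , c₂) ∷ []) _ cΠ≡±1 =
  ⊥-elim (generator≢±1 (generator-square gen) (begin
    d · d                   ≡⟨ cong₂ _·_ c₁ c₂ ⟨
    class g₁ · class g₂     ≡⟨ class-mul g₁ g₂ ⟨
    class (g₁ * g₂)         ≡⟨ cong (λ n → class (g₁ * n)) (ℕP.*-identityʳ g₂) ⟨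
    class (g₁ * (g₂ * 1))   ≡⟨ cΠ≡±1 ⟩
    ±1                      ∎))
  where open ≡-Reasoning
power-splits {d} gen (g₁ ∷ g₂ ∷ g₃ ∷ gs) ((p₁ , c₁) ∷ (p₂ , c₂) ∷ _) _ cΠ≡±1 =
  split₃ (prime⇒2≤ p₁) (prime⇒2≤ p₂) (class⇒2≤ (generator≢0₇ gen ∘ trans (sym cr≡d)) (generator≢±1 gen ∘ trans (sym cr≡d)))
         (trans c₁ (sym cr≡d)) (trans c₂ (sym cr≡d))
  where
  open ≡-Reasoning
  r = g₃ * prodℕ gs
  cr≡d : class r ≡ d
  cr≡d = ·-cancelˡ d (generator≢0₇ gen) (·-cancelˡ d (generator≢0₇ gen) (begin
    d · d · class r                 ≡⟨ cong₂ (λ u v → u · v · class r) c₁ c₂ ⟨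
    class g₁ · class g₂ · class r   ≡⟨ cong (class g₁ ·_) (class-mul g₂ r) ⟨
    class g₁ · class (g₂ * r)       ≡⟨ class-mul g₁ (g₂ * r) ⟨
    class (g₁ * (g₂ * r))           ≡⟨ cΠ≡±1 ⟩
    ±1                              ≡⟨ generator-cube gen ⟨
    d · d · d                       ∎))

record Sorted (d : Class) (x : ℕ) : Set where
  constructor sorted
  field
    ones ds d²s : List ℕ
    ones-ok     : All (PrimeOf ±1) ones
    ds-ok       : All (PrimeOf d) ds
    d²s-ok      : All (PrimeOf (d · d)) d²s
    product     : x ≡ prodℕ ones * (prodℕ ds * prodℕ d²s)

sort : ∀ {d} → Generator d → ∀ ps → All (λ p → Prime p × class p ≢ 0₇) ps → Sorted d (prodℕ ps)
sort gen []       []                          = sorted [] [] [] [] [] [] refl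
sort gen (p ∷ ps) ((p-prime , cp≢0) ∷ ps-ok) with sort gen ps ps-ok | nonzero-classes gen (class p) cp≢0
... | sorted os ds d²s os-ok ds-ok d²s-ok Π≡ | inj₁ cp≡±1 =
  sorted (p ∷ os) ds d²s ((p-prime , cp≡±1) ∷ os-ok) ds-ok d²s-ok (trans (cong (p *_) Π≡) (into-ones p (prodℕ os) (prodℕ ds) (prodℕ d²s)))
  where
  into-ones : ∀ p o d e → p * (o * (d * e)) ≡ (p * o) * (d * e)
  into-ones = solve-∀
... | sorted os ds d²s os-ok ds-ok d²s-ok Π≡ | inj₂ (inj₁ cp≡d) =
  sorted os (p ∷ ds) d²s os-ok ((p-prime , cp≡d) ∷ ds-ok) d²s-ok (trans (cong (p *_) Π≡) (into-ds p (prodℕ os) (prodℕ ds) (prodℕ d²s)))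
  where
  into-ds : ∀ p o d e → p * (o * (d * e)) ≡ o * ((p * d) * e)
  into-ds = solve-∀
... | sorted os ds d²s os-ok ds-ok d²s-ok Π≡ | inj₂ (inj₂ cp≡d²) =
  sorted os ds (p ∷ d²s) os-ok ds-ok ((p-prime , cp≡d²) ∷ d²s-ok) (trans (cong (p *_) Π≡) (into-d²s p (prodℕ os) (prodℕ ds) (prodℕ d²s)))
  where
  into-d²s : ∀ p o d e → p * (o * (d * e)) ≡ o * (d * (p * e))
  into-d²s = solve-∀

sorted-factorisation : ∀ {d x} → Generator d → 0 < x → ¬ 7 ∣ x → Sorted d x
sorted-factorisation {d} {x} gen 0<x 7∤x = subst (Sorted d) (sym isFactorisation) (sort gen factors (All.tabulate coprime-prime))
  where
  instance _ = ℕ.>-nonZero 0<x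
  open PrimeFactorisation (factorise x)
  coprime-prime : ∀ {p} → p ∈ factors → Prime p × class p ≢ 0₇
  coprime-prime {p} p∈ = All.lookup factorsPrime p∈ ,
    λ cp≡0 → 7∤x (ℕ∣.∣-trans (class≡0₇⇒7∣ cp≡0) (subst (p ∣_) (sym isFactorisation) (∈⇒∣product p∈)))

-- Class ±1: a prime e of class ±1 is a square root of class(x), as is the product
-- g·h of a ±2-prime and a ±3-prime; otherwise all primes share a generator class.
unit-case : ∀ {x} → Sorted ±2 x → class x ≡ ±1 → 1 < x → ¬ Splitting x →
            Prime x ⊎ ∃[ p ] ∃[ q ] (PrimeOf ±2 p × PrimeOf ±3 q × x ≡ p * q)
unit-case (sorted (e ∷ os) ds d²s ((e-prime , ce) ∷ _) _ _ x≡) cx _ unsplittable =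
  inj₁ (subst Prime (sym x≡e) e-prime)
  where
  x≡e = root-or-split (trans x≡ (ℕP.*-assoc e _ _)) (prime⇒2≤ e-prime) ce (λ ()) (sym cx) unsplittable
unit-case (sorted [] (g ∷ gs) (h ∷ hs) _ (g-ok@(g-prime , cg) ∷ _) (h-ok@(h-prime , ch) ∷ _) x≡) cx _ unsplittable =
  inj₂ (g , h , g-ok , h-ok , x≡gh)
  where
  regroup : ∀ g G h H → 1 * ((g * G) * (h * H)) ≡ (g * h) * (G * H)
  regroup = solve-∀
  2≤gh : 2 ≤ g * h
  2≤gh = ℕP.*-mono-≤ (prime⇒2≤ g-prime) (ℕP.<⇒≤ (prime⇒2≤ h-prime))
  x≡gh = root-or-split (trans x≡ (regroup g (prodℕ gs) h (prodℕ hs))) 2≤gh (trans (class-mul g h) (cong₂ _·_ cg ch))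
                       (λ ()) (sym cx) unsplittable
unit-case {x} (sorted [] gs [] _ gs-ok _ x≡) cx 1<x unsplittable =
  ⊥-elim (unsplittable (subst Splitting (sym x≡G)
    (power-splits ±2-generates gs gs-ok (subst (1 <_) x≡G 1<x) (subst (λ n → class n ≡ ±1) x≡G cx))))
  where
  x≡G : x ≡ prodℕ gs
  x≡G = trans x≡ (trans (ℕP.*-identityˡ _) (ℕP.*-identityʳ _))
unit-case {x} (sorted [] [] hs@(_ ∷ _) _ _ hs-ok x≡) cx 1<x unsplittable =
  ⊥-elim (unsplittable (subst Splitting (sym x≡H)
    (power-splits ±3-generates hs hs-ok (subst (1 <_) x≡H 1<x) (subst (λ n → class n ≡ ±1) x≡H cx))))
  where
  x≡H : x ≡ prodℕ hs
  x≡H = trans x≡ (trans (ℕP.*-identityˡ _) (ℕP.*-identityˡ _))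

OneExceptional : Class → ℕ → Set
OneExceptional c x = ∃[ ones ] ∃[ g ] (All (PrimeOf ±1) ones × PrimeOf c g × prodℕ (ones ++ g ∷ []) ≡ x)

-- Class d (a generator): a prime of class d·d, or a product of two primes of
-- class d, is a square root of d; so only ±1-primes and one d-prime remain.
exceptional-case : ∀ {d x} → Generator d → Sorted d x → class x ≡ d → ¬ Splitting x → OneExceptional d x
exceptional-case gen (sorted os ds (h ∷ hs) _ _ ((h-prime , ch) ∷ _) x≡) cx unsplittable =
  ⊥-elim (square≢generator gen (trans (sym ch) (trans (cong class (sym x≡h)) cx)))
  where
  regroup : ∀ o d h H → o * (d * (h * H)) ≡ h * (o * (d * H))
  regroup = solve-∀
  x≡h = root-or-split (trans x≡ (regroup (prodℕ os) (prodℕ ds) h (prodℕ hs))) (prime⇒2≤ h-prime) ch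
                      (generator≢0₇ (generator-square gen)) (trans (square-root-of-generator gen) (sym cx)) unsplittable
exceptional-case gen (sorted os (g₁ ∷ g₂ ∷ gs) [] _ ((p₁ , c₁) ∷ (p₂ , c₂) ∷ _) [] x≡) cx unsplittable =
  ⊥-elim (square≢generator gen (trans (sym cg₁g₂) (trans (cong class (sym x≡g₁g₂)) cx)))
  where
  regroup : ∀ o g₁ g₂ G → o * ((g₁ * (g₂ * G)) * 1) ≡ (g₁ * g₂) * (o * G)
  regroup = solve-∀
  cg₁g₂ = trans (class-mul g₁ g₂) (cong₂ _·_ c₁ c₂)
  x≡g₁g₂ = root-or-split (trans x≡ (regroup (prodℕ os) g₁ g₂ (prodℕ gs))) (ℕP.*-mono-≤ (prime⇒2≤ p₁) (ℕP.<⇒≤ (prime⇒2≤ p₂)))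
                         cg₁g₂ (generator≢0₇ (generator-square gen)) (trans (square-root-of-generator gen) (sym cx)) unsplittable
exceptional-case gen (sorted os (g ∷ []) [] os-ok (g-ok ∷ []) [] x≡) _ _ =
  os , g , os-ok , g-ok , trans (product-++ os (g ∷ [])) (sym (trans x≡ (cong (prodℕ os *_) (ℕP.*-identityʳ (g * 1)))))
exceptional-case gen (sorted os [] [] os-ok [] [] x≡) cx _ =
  ⊥-elim (generator≢±1 gen (trans (sym cx) (trans (cong class x≡)
    (trans (class-mul (prodℕ os) 1) (cong (_· ±1) (class-prod-±1 (All.map proj₂ os-ok)))))))

exceptional-form : ∀ {c x} → OneExceptional c x → ExactlyOneExceptional (canon c) x
exceptional-form (ones , g , ones-ok , (g-prime , cg) , Π≡x) =
  ones , g , [] , AllP.++⁺ (All.map proj₁ ones-ok) (g-prime ∷ []) , Π≡x ,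
  All.map (λ {q} (_ , cq) → class⇒±mod7 q cq) ones-ok , [] , class⇒±mod7 g cg

coprime-nonsplit⇒form : ∀ {x} → 1 < x → ¬ 7 ∣ x → ¬ Splitting x → Forms x
coprime-nonsplit⇒form {x} 1<x 7∤x unsplittable with class x in cx
... | ±1 with unit-case (sorted-factorisation ±2-generates (ℕP.<⇒≤ 1<x) 7∤x) cx 1<x unsplittable
...   | inj₁ x-prime = inj₁ x-prime
...   | inj₂ (p , q , (p-prime , cp) , (q-prime , cq) , x≡pq) =
        inj₂ (inj₂ (inj₂ (inj₂ (p , q , p-prime , q-prime , class⇒±mod7 p cp , class⇒±mod7 q cq , x≡pq))))
coprime-nonsplit⇒form {x} 1<x 7∤x unsplittable | ±2 =
  inj₂ (inj₂ (inj₁ (exceptional-form (exceptional-case ±2-generates (sorted-factorisation ±2-generates (ℕP.<⇒≤ 1<x) 7∤x) cx unsplittable))))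
coprime-nonsplit⇒form {x} 1<x 7∤x unsplittable | ±3 =
  inj₂ (inj₂ (inj₂ (inj₁ (exceptional-form (exceptional-case ±3-generates (sorted-factorisation ±3-generates (ℕP.<⇒≤ 1<x) 7∤x) cx unsplittable)))))
coprime-nonsplit⇒form {x} 1<x 7∤x unsplittable | 0₇ = ⊥-elim (7∤x (class≡0₇⇒7∣ cx))

-- 7 ∣ x but 49 ∤ x: the cofactor of 7 has no factor 7.
seven-form : ∀ {x} m → x ≡ m * 7 → 0 < x → ¬ 49 ∣ x → ∃[ ps ] (All (λ p → Prime p × p ≢ 7) ps × x ≡ 7 * prodℕ ps)
seven-form {x} m x≡m7 0<x 49∤x = factors , All.tabulate prime≢7 , trans x≡m7 (trans (ℕP.*-comm m 7) (cong (7 *_) isFactorisation))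
  where
  m≢0 : m ≢ 0
  m≢0 refl = ℕP.<-irrefl (sym x≡m7) 0<x
  instance _ = ℕ.≢-nonZero m≢0
  open PrimeFactorisation (factorise m)
  49∣m·7 : 7 ∣ m → 7 * 7 ∣ m * 7
  49∣m·7 = ℕ∣.*-monoˡ-∣ 7
  prime≢7 : ∀ {p} → p ∈ factors → Prime p × p ≢ 7
  prime≢7 {p} p∈ = All.lookup factorsPrime p∈ ,
    λ { refl → 49∤x (subst (49 ∣_) (sym x≡m7) (49∣m·7 (subst (7 ∣_) (sym isFactorisation) (∈⇒∣product p∈)))) }

-- Every non-splitting x > 1 has one of the five shapes: if 49 ∣ x then x = 7 · 7q
-- splits, if 7 ∥ x it has shape (ii), and otherwise x is coprime to 7.
nonsplit⇒form : ∀ {x} → 1 < x → ¬ Splitting x → Forms x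
nonsplit⇒form {x} 1<x unsplittable with 49 ∣? x
... | yes (divides q x≡q·49) =
  ⊥-elim (unsplittable (split₂ x≡7·7q 2≤7 (ℕP.≤-trans 2≤7 (ℕP.m≤m*n 7 q)) (sym (class-mul 7 q))))
  where
  2≤7 : 2 ≤ 7
  2≤7 = s≤s (s≤s z≤n)
  regroup : ∀ q → q * 49 ≡ 7 * (7 * q)
  regroup = solve-∀
  x≡7·7q : x ≡ 7 * (7 * q)
  x≡7·7q = trans x≡q·49 (regroup q)
  q≢0 : q ≢ 0
  q≢0 refl = ℕP.<-irrefl (sym x≡q·49) (ℕP.<⇒≤ 1<x)
  instance _ = ℕ.≢-nonZero q≢0
... | no 49∤x with 7 ∣? x
...   | yes (divides m x≡m·7) = inj₂ (inj₁ (seven-form m x≡m·7 (ℕP.<⇒≤ 1<x) 49∤x))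
...   | no 7∤x                = coprime-nonsplit⇒form 1<x 7∤x unsplittable

theorem10 : (x : ℕ) → 1 < x →
    τAtom 7 (+ x) ⇔
      ( Prime x
      ⊎ (∃[ ps ] (All (λ p → Prime p × p ≢ 7) ps × x ≡ 7 * prodℕ ps))
      ⊎ ExactlyOneExceptional 2 x
      ⊎ ExactlyOneExceptional 3 x
      ⊎ (∃[ p ] ∃[ q ] (Prime p × Prime q × (≡± 2 mod7) p × (≡± 3 mod7) q × x ≡ p * q)))
theorem10 x 1<x = mk⇔
  (λ (_ , no-proper-factorization) → nonsplit⇒form 1<x (no-proper-factorization ∘ splitting⇒proper))
  (λ form → 2≤⇒nonzeroNonunit 1<x , form⇒nonsplit form ∘ proper⇒splitting)
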